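{- For a connected bipartite graph $G$ whose two parts have sizes $n_1$ and $n_2$, $$0\le C(G)\le \frac{n_1n_2(n_1n_2-n_1-n_2+1)}{n_1+n_2-1}.$$ The first inequality is an equality if and only if $G$ is a tree. The second inequality is an equality if and only if $G=K_{n_1,n_2}$.
   Context: All graphs are finite and simple. For a connected graph $G$, regard each edge as a unit resistor. $\Omega_G(i,j)$ is the effective resistance (resistance distance) between $i$ and $j$. The global cyclicity index is $$C(G)=\sum_{ij\in E(G)}\Big[\frac{1}{\Omega_G(i,j)}-1\Big].$$ $K_{n_1,n_2}$ is the complete bipartite graph with parts of sizes $n_1$ and $n_2$. -}

module Defs where

open import Data.Nat using (ℕ; zero; suc)
open import Data.Fin using (Fin) renaming (_≟_ to _≟ᶠ_)
open import Data.Bool using (Bool; true; false; T; if_then_else_)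
open import Data.Sum using (_⊎_; inj₁; inj₂)
open import Data.Sum.Properties using (≡-dec)
open import Data.Product using (Σ; _×_)
open import Data.Unit using (⊤)
open import Data.Empty using (⊥)
open import Data.List using (List; []; _∷_; _++_; length)
open import Data.List.Relation.Unary.Unique.Propositional using (Unique)
open import Data.Integer using (+_)
open import Data.Rational using (ℚ; 0ℚ; 1ℚ; _+_; _*_; _-_; _/_; 1/_; ≢-nonZero)
open import Data.Rational.Properties using () renaming (_≟_ to _≟ℚ_)
open import Relation.Nullary using (¬_; yes; no)
open import Relation.Binary.PropositionalEquality using (_≡_)

ℕ→ℚ : ℕ → ℚ
ℕ→ℚ n = + n / 1

-- reciprocal, used only where the argument is nonzero (value 0 at 0)
inv : ℚ → ℚ
inv q with q ≟ℚ 0ℚ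
... | yes _ = 0ℚ
... | no ne = 1/_ q {{≢-nonZero ne}}

sumFin : (n : ℕ) → (Fin n → ℚ) → ℚ
sumFin zero    f = 0ℚ
sumFin (suc n) f = f Fin.zero + sumFin n (λ i → f (Fin.suc i))

-- A bipartite graph with parts X = Fin n₁ and Y = Fin n₂ is given by its
-- biadjacency matrix B : Fin n₁ → Fin n₂ → Bool (edge x–y iff B x y ≡ true).
-- Vertex set:
Vtx : ℕ → ℕ → Set
Vtx n₁ n₂ = Fin n₁ ⊎ Fin n₂

module _ {n₁ n₂ : ℕ} (B : Fin n₁ → Fin n₂ → Bool) where

  Adj : Vtx n₁ n₂ → Vtx n₁ n₂ → Set
  Adj (inj₁ i) (inj₁ i') = ⊥
  Adj (inj₁ i) (inj₂ j)  = T (B i j)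
  Adj (inj₂ j) (inj₁ i)  = T (B i j)
  Adj (inj₂ j) (inj₂ j') = ⊥

  data Reach : Vtx n₁ n₂ → Vtx n₁ n₂ → Set where
    here : ∀ {u} → Reach u u
    step : ∀ {u w v} → Adj u w → Reach w v → Reach u v

  Connected : Set
  Connected = ∀ u v → Reach u v

  Chain : List (Vtx n₁ n₂) → Set
  Chain []           = ⊤
  Chain (x ∷ [])     = ⊤
  Chain (x ∷ y ∷ rs) = Adj x y × Chain (y ∷ rs)

  IsCycle : Vtx n₁ n₂ → List (Vtx n₁ n₂) → Set
  IsCycle v ws = (2 Data.Nat.≤ length ws) × Unique (v ∷ ws) × Chain (v ∷ ws ++ v ∷ [])

  Acyclic : Set
  Acyclic = ∀ v ws → ¬ IsCycle v ws

  IsTree : Set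
  IsTree = Connected × Acyclic

  IsComplete : Set
  IsComplete = ∀ i j → B i j ≡ true

  _≟ᵛ_ : (u v : Vtx n₁ n₂) → Relation.Nullary.Dec (u ≡ v)
  _≟ᵛ_ = ≡-dec _≟ᶠ_ _≟ᶠ_

  δ : Vtx n₁ n₂ → Vtx n₁ n₂ → ℚ
  δ u w with u ≟ᵛ w
  ... | yes _ = 1ℚ
  ... | no  _ = 0ℚ

  ind : Bool → ℚ → ℚ
  ind b q = if b then q else 0ℚ

  Lap : (Vtx n₁ n₂ → ℚ) → Vtx n₁ n₂ → ℚ
  Lap x (inj₁ i) = sumFin n₂ (λ j → ind (B i j) (x (inj₁ i) - x (inj₂ j)))
  Lap x (inj₂ j) = sumFin n₁ (λ i → ind (B i j) (x (inj₂ j) - x (inj₁ i)))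

  -- Ω is the effective resistance of the unit-resistor network:
  -- for each u v there is a potential x realising a unit current
  -- injected at u and extracted at v (Kirchhoff/Ohm: Lap x = e_u − e_v),
  -- and Ω u v is the resulting potential difference x u − x v.
  IsResistanceDistance : (Vtx n₁ n₂ → Vtx n₁ n₂ → ℚ) → Set
  IsResistanceDistance Ω = ∀ u v → Σ (Vtx n₁ n₂ → ℚ) λ x →
    (∀ w → Lap x w ≡ δ u w - δ v w) × (Ω u v ≡ x u - x v)

  cyclicity : (Vtx n₁ n₂ → Vtx n₁ n₂ → ℚ) → ℚ
  cyclicity Ω = sumFin n₁ (λ i → sumFin n₂ (λ j →
    ind (B i j) (inv (Ω (inj₁ i) (inj₂ j)) - 1ℚ)))

upperBound : ℕ → ℕ → ℚ
upperBound n₁ n₂ =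
  (ℕ→ℚ n₁ * ℕ→ℚ n₂ * (ℕ→ℚ n₁ * ℕ→ℚ n₂ - ℕ→ℚ n₁ - ℕ→ℚ n₂ + 1ℚ))
  * inv (ℕ→ℚ n₁ + ℕ→ℚ n₂ - 1ℚ)

-- Fix an edge ij, let x be the potential of a unit current from i to j and Ω = x_i − x_j.
-- Green's identity gives energy(φ, x) = φ_i − φ_j for every φ; hence the energy of x is Ω,
-- and as the edge ij alone dissipates Ω², we get 0 < Ω ≤ 1 and C(G) ≥ 0. Expanding
-- energy(x − φ) ≥ 0 gives Dirichlet's principle 2(φ_i − φ_j) − energy(φ) ≤ Ω. Applied to the
-- unit-current potential of K_{n₁,n₂}, whose energy in G is at most its energy in K_{n₁,n₂},
-- it gives Ω ≥ r = (n₁ + n₂ − 1)/(n₁n₂), with equality when G is complete. Summing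
-- 1/Ω − 1 ≤ 1/r − 1 over all n₁n₂ pairs gives the upper bound; in the equality case every
-- pair is an edge unless 1/r = 1, i.e. G is a star, which is complete anyway.
-- C(G) = 0 exactly when every edge has resistance 1. In a tree, Dirichlet's principle with the
-- indicator of the component of i in G − ij gives Ω ≥ 1. Conversely, if Ω = 1 then all the
-- energy sits on ij, so x is constant across every other edge, and a cycle through ij would
-- force x_i = x_j.

module Submission where

open import Data.Nat as ℕ using (ℕ; zero; suc; s≤s; z≤n)
import Data.Nat.Properties as ℕ
import Data.Integer as ℤ
import Data.Integer.Properties as ℤ
open import Data.Nat.Coprimality as Coprime using (1-coprimeTo)
open import Data.Rational
  using (ℚ; mkℚ; 0ℚ; 1ℚ; _+_; _*_; _-_; -_; _≤_; _<_; _/_; Positive; positive; nonNegative; ≢-nonZero)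
open import Data.Rational.Properties
open import Data.Fin using (Fin) renaming (zero to fzero; suc to fsuc)
import Data.Fin.Properties as Fin
open import Function using (_∘_)
open import Data.Bool using (Bool; true; false; T; if_then_else_; _∧_; _∨_; not)
open import Data.Bool.Properties using (T-≡; T-not-≡; T-∧; T-∨)
open import Function.Bundles using (Equivalence; _⇔_; mk⇔)
open import Data.Sum using (_⊎_; inj₁; inj₂; swap)
open import Data.Sum.Properties using (inj₁-injective; inj₂-injective; ≡-dec)
open import Data.Product using (Σ; _×_; _,_; proj₁; proj₂)
open import Data.Empty using (⊥; ⊥-elim)
open import Data.List using (List; []; _∷_; _++_; length)
open import Data.List.Relation.Unary.Any using (Any; here; there; any?)
open import Data.List.Relation.Unary.All using (All; []; _∷_)
open import Data.List.Relation.Unary.All.Properties using (¬Any⇒All¬)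
open import Data.List.Relation.Unary.AllPairs using ([]; _∷_)
open import Data.List.Relation.Unary.Unique.Propositional using (Unique)
open import Data.Unit using (⊤)
open import Relation.Nullary.Decidable using (dec⇒maybe; isYes; fromWitness; toWitness)
open import Relation.Nullary using (¬_; yes; no)
open import Relation.Binary.PropositionalEquality
open import Tactic.RingSolver.Core.AlmostCommutativeRing using (AlmostCommutativeRing; fromCommutativeRing)
open import Tactic.RingSolver using (solve-∀)
open import Defs

ℚ-ring : AlmostCommutativeRing _ _
ℚ-ring = fromCommutativeRing +-*-commutativeRing (λ p → dec⇒maybe (0ℚ ≟ p))

p≤q⇒0≤q-p : ∀ {p q} → p ≤ q → 0ℚ ≤ q - p
p≤q⇒0≤q-p {p} {q} p≤q = subst (_≤ q - p) (+-inverseʳ p) (+-monoˡ-≤ (- p) p≤q)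

0≤q-p⇒p≤q : ∀ {p q} → 0ℚ ≤ q - p → p ≤ q
0≤q-p⇒p≤q {p} {q} 0≤q-p = subst₂ _≤_ (+-identityˡ p) (q-p+p≡q p q) (+-monoˡ-≤ p 0≤q-p)
  where
  q-p+p≡q : ∀ p q → q - p + p ≡ q
  q-p+p≡q = solve-∀ ℚ-ring

p-q≡0⇒p≡q : ∀ {p q} → p - q ≡ 0ℚ → p ≡ q
p-q≡0⇒p≡q {p} {q} p-q≡0 = begin
  p           ≡⟨ p≡p-q+q p q ⟩
  p - q + q   ≡⟨ cong (_+ q) p-q≡0 ⟩
  0ℚ + q      ≡⟨ +-identityˡ q ⟩
  q           ∎
  where
  open ≡-Reasoning
  p≡p-q+q : ∀ p q → p ≡ p - q + q
  p≡p-q+q = solve-∀ ℚ-ring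

0<⇒≢0 : ∀ {p} → 0ℚ < p → p ≢ 0ℚ
0<⇒≢0 0<p p≡0 = <-irrefl (sym p≡0) 0<p

0≤*0≤⇒0≤* : ∀ {p q} → 0ℚ ≤ p → 0ℚ ≤ q → 0ℚ ≤ p * q
0≤*0≤⇒0≤* {p} {q} 0≤p 0≤q =
  nonNegative⁻¹ _ {{nonNeg*nonNeg⇒nonNeg p {{nonNegative 0≤p}} q {{nonNegative 0≤q}}}}

0≤p*p : ∀ p → 0ℚ ≤ p * p
0≤p*p p with ≤-total 0ℚ p
... | inj₁ 0≤p = 0≤*0≤⇒0≤* 0≤p 0≤p
... | inj₂ p≤0 = subst (0ℚ ≤_) (-p*-p≡p*p p) (0≤*0≤⇒0≤* (neg-antimono-≤ p≤0) (neg-antimono-≤ p≤0))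
  where
  -p*-p≡p*p : ∀ p → (- p) * (- p) ≡ p * p
  -p*-p≡p*p = solve-∀ ℚ-ring

inv-inverseˡ : ∀ {p} → p ≢ 0ℚ → inv p * p ≡ 1ℚ
inv-inverseˡ {p} p≢0 with p ≟ 0ℚ
... | yes p≡0 = ⊥-elim (p≢0 p≡0)
... | no p≢0′ = *-inverseˡ p {{≢-nonZero p≢0′}}

inv-inverseʳ : ∀ {p} → p ≢ 0ℚ → p * inv p ≡ 1ℚ
inv-inverseʳ {p} p≢0 = trans (*-comm p (inv p)) (inv-inverseˡ p≢0)

*≡1⇒inv≡ : ∀ {p q} → p * q ≡ 1ℚ → inv p ≡ q
*≡1⇒inv≡ {p} {q} pq≡1 = begin
  inv p             ≡⟨ sym (*-identityʳ (inv p)) ⟩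
  inv p * 1ℚ        ≡⟨ cong (inv p *_) (sym pq≡1) ⟩
  inv p * (p * q)   ≡⟨ sym (*-assoc (inv p) p q) ⟩
  inv p * p * q     ≡⟨ cong (_* q) (inv-inverseˡ p≢0) ⟩
  1ℚ * q            ≡⟨ *-identityˡ q ⟩
  q                 ∎
  where
  open ≡-Reasoning
  p≢0 : p ≢ 0ℚ
  p≢0 p≡0 = 1≢0 (trans (sym pq≡1) (trans (cong (_* q) p≡0) (*-zeroˡ q)))

*≡0⇒≡0 : ∀ p q → p * q ≡ 0ℚ → p ≡ 0ℚ ⊎ q ≡ 0ℚ
*≡0⇒≡0 p q pq≡0 with p ≟ 0ℚ
... | yes p≡0 = inj₁ p≡0
... | no p≢0 = inj₂ (begin
  q                 ≡⟨ sym (*-identityˡ q) ⟩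
  1ℚ * q            ≡⟨ cong (_* q) (sym (inv-inverseˡ p≢0)) ⟩
  inv p * p * q     ≡⟨ *-assoc (inv p) p q ⟩
  inv p * (p * q)   ≡⟨ cong (inv p *_) pq≡0 ⟩
  inv p * 0ℚ        ≡⟨ *-zeroʳ (inv p) ⟩
  0ℚ                ∎)
  where open ≡-Reasoning

p*p≡0⇒p≡0 : ∀ p → p * p ≡ 0ℚ → p ≡ 0ℚ
p*p≡0⇒p≡0 p pp≡0 with *≡0⇒≡0 p p pp≡0
... | inj₁ p≡0 = p≡0
... | inj₂ p≡0 = p≡0

inv-pos : ∀ {p} → 0ℚ < p → 0ℚ < inv p
inv-pos {p} 0<p with p ≟ 0ℚ
... | yes p≡0 = ⊥-elim (0<⇒≢0 0<p p≡0)
... | no _ = positive⁻¹ _ {{1/pos⇒pos p {{positive 0<p}}}}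

inv-antimono : ∀ {p q} → 0ℚ < p → p ≤ q → inv q ≤ inv p
inv-antimono {p} {q} 0<p p≤q = begin
  inv q                   ≡⟨ sym (*-identityʳ (inv q)) ⟩
  inv q * 1ℚ              ≡⟨ cong (inv q *_) (sym (inv-inverseʳ (0<⇒≢0 0<p))) ⟩
  inv q * (p * inv p)     ≤⟨ *-monoˡ-≤-nonNeg (inv q) {{nonNegative (<⇒≤ (inv-pos 0<q))}}
                               (*-monoʳ-≤-nonNeg (inv p) {{nonNegative (<⇒≤ (inv-pos 0<p))}} p≤q) ⟩
  inv q * (q * inv p)     ≡⟨ sym (*-assoc (inv q) q (inv p)) ⟩
  inv q * q * inv p       ≡⟨ cong (_* inv p) (inv-inverseˡ (0<⇒≢0 0<q)) ⟩
  1ℚ * inv p              ≡⟨ *-identityˡ (inv p) ⟩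
  inv p                   ∎
  where
  open ≤-Reasoning
  0<q : 0ℚ < q
  0<q = <-≤-trans 0<p p≤q

inv≡1⇒≡1 : ∀ {p} → inv p ≡ 1ℚ → p ≡ 1ℚ
inv≡1⇒≡1 {p} inv-p≡1 = begin
  p              ≡⟨ sym (*-identityʳ p) ⟩
  p * 1ℚ         ≡⟨ cong (p *_) (sym inv-p≡1) ⟩
  p * inv p      ≡⟨ inv-inverseʳ p≢0 ⟩
  1ℚ             ∎
  where
  open ≡-Reasoning
  p≢0 : p ≢ 0ℚ
  p≢0 refl = 1≢0 (sym inv-p≡1)

ℕ→ℚ≡mkℚ : ∀ n → ℕ→ℚ n ≡ mkℚ (ℤ.+ n) 0 (Coprime.sym (1-coprimeTo n))
ℕ→ℚ≡mkℚ n = ↥p/↧p≡p (mkℚ (ℤ.+ n) 0 (Coprime.sym (1-coprimeTo n)))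

ℕ→ℚ-suc : ∀ n → ℕ→ℚ (suc n) ≡ 1ℚ + ℕ→ℚ n
ℕ→ℚ-suc n rewrite ℕ→ℚ≡mkℚ n =
  cong (_/ 1) (sym (cong (λ k → ℤ.1ℤ ℤ.+ k) (ℤ.*-identityʳ (ℤ.+ n))))

ℕ→ℚ≡1⇒≡1 : ∀ {n} → ℕ→ℚ n ≡ 1ℚ → n ≡ 1
ℕ→ℚ≡1⇒≡1 {n} eq with trans (sym (ℕ→ℚ≡mkℚ n)) eq
... | refl = refl

0≤ℕ→ℚ : ∀ n → 0ℚ ≤ ℕ→ℚ n
0≤ℕ→ℚ zero = ≤-refl
0≤ℕ→ℚ (suc n) =
  subst (0ℚ ≤_) (sym (ℕ→ℚ-suc n)) (+-mono-≤ (<⇒≤ (positive⁻¹ 1ℚ)) (0≤ℕ→ℚ n))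

1≤ℕ→ℚ : ∀ {n} → 1 ℕ.≤ n → 1ℚ ≤ ℕ→ℚ n
1≤ℕ→ℚ {suc n} _ = subst₂ _≤_ (+-identityʳ 1ℚ) (sym (ℕ→ℚ-suc n)) (+-monoʳ-≤ 1ℚ (0≤ℕ→ℚ n))

0<ℕ→ℚ : ∀ {n} → 1 ℕ.≤ n → 0ℚ < ℕ→ℚ n
0<ℕ→ℚ 1≤n = <-≤-trans (positive⁻¹ 1ℚ) (1≤ℕ→ℚ 1≤n)

sumFin-cong : ∀ n {f g : Fin n → ℚ} → (∀ k → f k ≡ g k) → sumFin n f ≡ sumFin n g
sumFin-cong zero    f≗g = refl
sumFin-cong (suc n) f≗g = cong₂ _+_ (f≗g fzero) (sumFin-cong n (λ k → f≗g (fsuc k)))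

sumFin-+ : ∀ n (f g : Fin n → ℚ) → sumFin n (λ k → f k + g k) ≡ sumFin n f + sumFin n g
sumFin-+ zero    f g = refl
sumFin-+ (suc n) f g = trans (cong ((f fzero + g fzero) +_) (sumFin-+ n _ _))
  (interchange (f fzero) (g fzero) (sumFin n (λ k → f (fsuc k))) (sumFin n (λ k → g (fsuc k))))
  where
  interchange : ∀ a b c d → a + b + (c + d) ≡ a + c + (b + d)
  interchange = solve-∀ ℚ-ring

sumFin-*ˡ : ∀ n c (f : Fin n → ℚ) → sumFin n (λ k → c * f k) ≡ c * sumFin n f
sumFin-*ˡ zero    c f = sym (*-zeroʳ c)
sumFin-*ˡ (suc n) c f = trans (cong (c * f fzero +_) (sumFin-*ˡ n c _)) (sym (*-distribˡ-+ c (f fzero) _))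

sumFin-neg : ∀ n (f : Fin n → ℚ) → sumFin n (λ k → - f k) ≡ - sumFin n f
sumFin-neg zero    f = refl
sumFin-neg (suc n) f = trans (cong (- f fzero +_) (sumFin-neg n _)) (sym (neg-distrib-+ (f fzero) _))

sumFin-- : ∀ n (f g : Fin n → ℚ) → sumFin n (λ k → f k - g k) ≡ sumFin n f - sumFin n g
sumFin-- n f g = trans (sumFin-+ n f (λ k → - g k)) (cong (sumFin n f +_) (sumFin-neg n g))

sumFin-const : ∀ n c → sumFin n (λ _ → c) ≡ ℕ→ℚ n * c
sumFin-const zero    c = sym (*-zeroˡ c)
sumFin-const (suc n) c = begin
  c + sumFin n (λ _ → c)   ≡⟨ cong (c +_) (sumFin-const n c) ⟩
  c + ℕ→ℚ n * c            ≡⟨ c+mc≡[1+m]c c (ℕ→ℚ n) ⟩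
  (1ℚ + ℕ→ℚ n) * c         ≡⟨ cong (_* c) (sym (ℕ→ℚ-suc n)) ⟩
  ℕ→ℚ (suc n) * c          ∎
  where
  open ≡-Reasoning
  c+mc≡[1+m]c : ∀ c m → c + m * c ≡ (1ℚ + m) * c
  c+mc≡[1+m]c = solve-∀ ℚ-ring

sumFin-0 : ∀ n {f : Fin n → ℚ} → (∀ k → f k ≡ 0ℚ) → sumFin n f ≡ 0ℚ
sumFin-0 zero    f≗0 = refl
sumFin-0 (suc n) f≗0 = cong₂ _+_ (f≗0 fzero) (sumFin-0 n (λ k → f≗0 (fsuc k)))

sumFin-single : ∀ n {f : Fin n → ℚ} a → (∀ k → k ≢ a → f k ≡ 0ℚ) → sumFin n f ≡ f a
sumFin-single (suc n) {f} fzero    f≗0 =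
  trans (cong (f fzero +_) (sumFin-0 n (λ k → f≗0 (fsuc k) (λ ())))) (+-identityʳ (f fzero))
sumFin-single (suc n) {f} (fsuc a) f≗0 =
  trans (cong₂ _+_ (f≗0 fzero (λ ()))
                   (sumFin-single n a (λ k k≢a → f≗0 (fsuc k) (k≢a ∘ Fin.suc-injective))))
        (+-identityˡ (f (fsuc a)))

sumFin-swap : ∀ m n (f : Fin m → Fin n → ℚ) →
  sumFin m (λ i → sumFin n (f i)) ≡ sumFin n (λ j → sumFin m (λ i → f i j))
sumFin-swap zero    n f = sym (sumFin-0 n (λ _ → refl))
sumFin-swap (suc m) n f =
  trans (cong (sumFin n (f fzero) +_) (sumFin-swap m n (λ i → f (fsuc i)))) (sym (sumFin-+ n (f fzero) _))

sumFin-mono : ∀ n {f g : Fin n → ℚ} → (∀ k → f k ≤ g k) → sumFin n f ≤ sumFin n g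
sumFin-mono zero    f≤g = ≤-refl
sumFin-mono (suc n) f≤g = +-mono-≤ (f≤g fzero) (sumFin-mono n (λ k → f≤g (fsuc k)))

sumFin-nonneg : ∀ n {f : Fin n → ℚ} → (∀ k → 0ℚ ≤ f k) → 0ℚ ≤ sumFin n f
sumFin-nonneg n {f} 0≤f = subst (_≤ sumFin n f) (sumFin-0 n (λ _ → refl)) (sumFin-mono n 0≤f)

term≤sumFin : ∀ n {f : Fin n → ℚ} → (∀ k → 0ℚ ≤ f k) → ∀ a → f a ≤ sumFin n f
term≤sumFin (suc n) {f} 0≤f fzero =
  subst (_≤ sumFin (suc n) f) (+-identityʳ (f fzero)) (+-monoʳ-≤ (f fzero) (sumFin-nonneg n (0≤f ∘ fsuc)))
term≤sumFin (suc n) {f} 0≤f (fsuc a) =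
  subst (_≤ sumFin (suc n) f) (+-identityˡ (f (fsuc a)))
        (+-mono-≤ (0≤f fzero) (term≤sumFin n (0≤f ∘ fsuc) a))

pair≤sumFin : ∀ n {f : Fin n → ℚ} → (∀ k → 0ℚ ≤ f k) → ∀ {a b} → a ≢ b → f a + f b ≤ sumFin n f
pair≤sumFin (suc n)     0≤f {fzero}  {fzero}  a≢b = ⊥-elim (a≢b refl)
pair≤sumFin (suc n) {f} 0≤f {fzero}  {fsuc b} a≢b = +-monoʳ-≤ (f fzero) (term≤sumFin n (0≤f ∘ fsuc) b)
pair≤sumFin (suc n) {f} 0≤f {fsuc a} {fzero}  a≢b =
  subst (_≤ sumFin (suc n) f) (+-comm (f fzero) (f (fsuc a)))
        (+-monoʳ-≤ (f fzero) (term≤sumFin n (0≤f ∘ fsuc) a))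
pair≤sumFin (suc n) {f} 0≤f {fsuc a} {fsuc b} a≢b =
  subst (_≤ sumFin (suc n) f) (+-identityˡ _)
        (+-mono-≤ (0≤f fzero) (pair≤sumFin n (0≤f ∘ fsuc) (a≢b ∘ cong fsuc)))

+-mono-≤-≡ : ∀ {a b c d} → a ≤ c → b ≤ d → a + b ≡ c + d → a ≡ c × b ≡ d
+-mono-≤-≡ a≤c b≤d eq =
  ≤-antisym a≤c (≮⇒≥ λ c<a → <-irrefl eq (+-mono-<-≤ c<a b≤d)) ,
  ≤-antisym b≤d (≮⇒≥ λ d<b → <-irrefl eq (+-mono-≤-< a≤c d<b))

sumFin-mono-≡ : ∀ n {f g : Fin n → ℚ} → (∀ k → f k ≤ g k) → sumFin n f ≡ sumFin n g →
  ∀ k → f k ≡ g k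
sumFin-mono-≡ (suc n) f≤g eq k with +-mono-≤-≡ (f≤g fzero) (sumFin-mono n (λ k → f≤g (fsuc k))) eq
sumFin-mono-≡ (suc n) f≤g eq fzero    | eq₀ , _  = eq₀
sumFin-mono-≡ (suc n) f≤g eq (fsuc k) | _ , eqₛ = sumFin-mono-≡ n (λ k → f≤g (fsuc k)) eqₛ k

-- guard coincides with ind of Defs, so cyclicity B Ω unfolds to a sumE below.
guard : Bool → ℚ → ℚ
guard b q = if b then q else 0ℚ

guard-*ˡ : ∀ b c q → guard b (c * q) ≡ c * guard b q
guard-*ˡ true  c q = refl
guard-*ˡ false c q = sym (*-zeroʳ c)

guard-+ : ∀ b p q → guard b (p + q) ≡ guard b p + guard b q
guard-+ true  p q = refl
guard-+ false p q = refl

guard-- : ∀ b p q → guard b (p - q) ≡ guard b p - guard b q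
guard-- true  p q = refl
guard-- false p q = refl

guard-nonneg : ∀ b {q} → (b ≡ true → 0ℚ ≤ q) → 0ℚ ≤ guard b q
guard-nonneg true  0≤q = 0≤q refl
guard-nonneg false 0≤q = ≤-refl

guard-≤ : ∀ b {q u} → 0ℚ ≤ u → (b ≡ true → q ≤ u) → guard b q ≤ u
guard-≤ true  0≤u q≤u = q≤u refl
guard-≤ false 0≤u q≤u = 0≤u

-- Electrical networks on a bipartite graph

module Network {n₁ n₂ : ℕ} where

  Graph : Set
  Graph = Fin n₁ → Fin n₂ → Bool

  V : Set
  V = Vtx n₁ n₂

  sum₂ : (Fin n₁ → Fin n₂ → ℚ) → ℚ
  sum₂ f = sumFin n₁ (λ i → sumFin n₂ (f i))

  sum₂-cong : ∀ {f g : Fin n₁ → Fin n₂ → ℚ} → (∀ i j → f i j ≡ g i j) → sum₂ f ≡ sum₂ g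
  sum₂-cong f≗g = sumFin-cong n₁ (λ i → sumFin-cong n₂ (f≗g i))

  sum₂-+ : ∀ f g → sum₂ (λ i j → f i j + g i j) ≡ sum₂ f + sum₂ g
  sum₂-+ f g = trans (sumFin-cong n₁ (λ i → sumFin-+ n₂ (f i) (g i))) (sumFin-+ n₁ _ _)

  sum₂-- : ∀ f g → sum₂ (λ i j → f i j - g i j) ≡ sum₂ f - sum₂ g
  sum₂-- f g = trans (sumFin-cong n₁ (λ i → sumFin-- n₂ (f i) (g i))) (sumFin-- n₁ _ _)

  sum₂-const : ∀ c → sum₂ (λ _ _ → c) ≡ ℕ→ℚ n₁ * (ℕ→ℚ n₂ * c)
  sum₂-const c = trans (sumFin-cong n₁ (λ _ → sumFin-const n₂ c)) (sumFin-const n₁ _)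

  sum₂-mono : ∀ {f g} → (∀ i j → f i j ≤ g i j) → sum₂ f ≤ sum₂ g
  sum₂-mono f≤g = sumFin-mono n₁ (λ i → sumFin-mono n₂ (f≤g i))

  sum₂-nonneg : ∀ {f} → (∀ i j → 0ℚ ≤ f i j) → 0ℚ ≤ sum₂ f
  sum₂-nonneg 0≤f = sumFin-nonneg n₁ (λ i → sumFin-nonneg n₂ (0≤f i))

  term≤sum₂ : ∀ {f} → (∀ i j → 0ℚ ≤ f i j) → ∀ i j → f i j ≤ sum₂ f
  term≤sum₂ 0≤f i j = ≤-trans (term≤sumFin n₂ (0≤f i) j)
                              (term≤sumFin n₁ (λ i → sumFin-nonneg n₂ (0≤f i)) i)

  sum₂-mono-≡ : ∀ {f g} → (∀ i j → f i j ≤ g i j) → sum₂ f ≡ sum₂ g → ∀ i j → f i j ≡ g i j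
  sum₂-mono-≡ f≤g eq i =
    sumFin-mono-≡ n₂ (f≤g i) (sumFin-mono-≡ n₁ (λ i → sumFin-mono n₂ (f≤g i)) eq i)

  pair≤sum₂ : ∀ {f} → (∀ i j → 0ℚ ≤ f i j) →
    ∀ {i j i′ j′} → ¬ (i ≡ i′ × j ≡ j′) → f i j + f i′ j′ ≤ sum₂ f
  pair≤sum₂ {f} 0≤f {i} {j} {i′} {j′} distinct with i Fin.≟ i′
  ... | yes refl = ≤-trans (pair≤sumFin n₂ (0≤f i) (λ j≡j′ → distinct (refl , j≡j′)))
                           (term≤sumFin n₁ (λ i → sumFin-nonneg n₂ (0≤f i)) i)
  ... | no i≢i′  = ≤-trans (+-mono-≤ (term≤sumFin n₂ (0≤f i) j) (term≤sumFin n₂ (0≤f i′) j′))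
                           (pair≤sumFin n₁ (λ i → sumFin-nonneg n₂ (0≤f i)) i≢i′)

  sum₂-single : ∀ {f} i₀ j₀ → (∀ i j → ¬ (i ≡ i₀ × j ≡ j₀) → f i j ≡ 0ℚ) →
    sum₂ f ≡ f i₀ j₀
  sum₂-single i₀ j₀ f≗0 =
    trans (sumFin-single n₁ i₀ (λ i i≢i₀ → sumFin-0 n₂ (λ j → f≗0 i j (i≢i₀ ∘ proj₁))))
          (sumFin-single n₂ j₀ (λ j j≢j₀ → f≗0 i₀ j (j≢j₀ ∘ proj₂)))

  sumE : Graph → (Fin n₁ → Fin n₂ → ℚ) → ℚ
  sumE C f = sum₂ (λ i j → guard (C i j) (f i j))

  sumE-cong : ∀ C {f g} → (∀ i j → f i j ≡ g i j) → sumE C f ≡ sumE C g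
  sumE-cong C f≗g = sum₂-cong (λ i j → cong (guard (C i j)) (f≗g i j))

  sumE-+ : ∀ C f g → sumE C (λ i j → f i j + g i j) ≡ sumE C f + sumE C g
  sumE-+ C f g = trans (sum₂-cong (λ i j → guard-+ (C i j) (f i j) (g i j))) (sum₂-+ _ _)

  sumE-- : ∀ C f g → sumE C (λ i j → f i j - g i j) ≡ sumE C f - sumE C g
  sumE-- C f g = trans (sum₂-cong (λ i j → guard-- (C i j) (f i j) (g i j))) (sum₂-- _ _)

  sumE-nonneg : ∀ C {f} → (∀ i j → 0ℚ ≤ f i j) → 0ℚ ≤ sumE C f
  sumE-nonneg C 0≤f = sum₂-nonneg (λ i j → guard-nonneg (C i j) (λ _ → 0≤f i j))

  sumV : (V → ℚ) → ℚ
  sumV g = sumFin n₁ (g ∘ inj₁) + sumFin n₂ (g ∘ inj₂)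

  sumV-cong : ∀ {f g : V → ℚ} → (∀ w → f w ≡ g w) → sumV f ≡ sumV g
  sumV-cong f≗g = cong₂ _+_ (sumFin-cong n₁ (f≗g ∘ inj₁)) (sumFin-cong n₂ (f≗g ∘ inj₂))

  sumV-- : ∀ f g → sumV (λ w → f w - g w) ≡ sumV f - sumV g
  sumV-- f g = trans (cong₂ _+_ (sumFin-- n₁ (f ∘ inj₁) (g ∘ inj₁)) (sumFin-- n₂ (f ∘ inj₂) (g ∘ inj₂)))
                     (interchange (Σ₁ f) (Σ₁ g) (Σ₂ f) (Σ₂ g))
    where
    Σ₁ Σ₂ : (V → ℚ) → ℚ
    Σ₁ h = sumFin n₁ (h ∘ inj₁)
    Σ₂ h = sumFin n₂ (h ∘ inj₂)
    interchange : ∀ a b c d → a - b + (c - d) ≡ a + c - (b + d)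
    interchange = solve-∀ ℚ-ring

  drop : (V → ℚ) → Fin n₁ → Fin n₂ → ℚ
  drop x i j = x (inj₁ i) - x (inj₂ j)

  energy : Graph → (V → ℚ) → (V → ℚ) → ℚ
  energy C φ x = sumE C (λ i j → drop φ i j * drop x i j)

  green-identity : ∀ C φ x → sumV (λ w → φ w * Lap C x w) ≡ energy C φ x
  green-identity C φ x = begin
    sumV (λ w → φ w * Lap C x w)
      ≡⟨ cong₂ _+_ (sumFin-cong n₁ (λ i → pull-in (C i) (φ (inj₁ i)) (drop x i)))
                   (trans (sumFin-cong n₂ (λ j → pull-in (λ i → C i j) (φ (inj₂ j)) (λ i → x₂ j - x₁ i)))
                          (sym (sumFin-swap n₁ n₂ _))) ⟩
    sumE C (λ i j → φ (inj₁ i) * drop x i j) + sumE C (λ i j → φ (inj₂ j) * (x₂ j - x₁ i))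
      ≡⟨ sym (sumE-+ C _ _) ⟩
    sumE C (λ i j → φ (inj₁ i) * drop x i j + φ (inj₂ j) * (x₂ j - x₁ i))
      ≡⟨ sumE-cong C (λ i j → product-rule (φ (inj₁ i)) (φ (inj₂ j)) (x₁ i) (x₂ j)) ⟩
    energy C φ x ∎
    where
    open ≡-Reasoning
    x₁ : Fin n₁ → ℚ
    x₁ = x ∘ inj₁
    x₂ : Fin n₂ → ℚ
    x₂ = x ∘ inj₂
    pull-in : ∀ {n} (b : Fin n → Bool) c q →
      c * sumFin n (λ k → guard (b k) (q k)) ≡ sumFin n (λ k → guard (b k) (c * q k))
    pull-in {n} b c q = sym (trans (sumFin-cong n (λ k → guard-*ˡ (b k) c (q k))) (sumFin-*ˡ n c q′))
      where q′ = λ k → guard (b k) (q k)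
    product-rule : ∀ a b p q → a * (p - q) + b * (q - p) ≡ (a - b) * (p - q)
    product-rule = solve-∀ ℚ-ring

  adjᵇ : Graph → V → V → Bool
  adjᵇ C (inj₁ i) (inj₂ j) = C i j
  adjᵇ C (inj₂ j) (inj₁ i) = C i j
  adjᵇ C (inj₁ _) (inj₁ _) = false
  adjᵇ C (inj₂ _) (inj₂ _) = false

  adjᵇ⇒Adj : ∀ C {a b} → T (adjᵇ C a b) → Adj C a b
  adjᵇ⇒Adj C {inj₁ i} {inj₂ j} adj = adj
  adjᵇ⇒Adj C {inj₂ j} {inj₁ i} adj = adj

  adjᵇ-mono : ∀ {C D} → (∀ i j → T (C i j) → T (D i j)) → ∀ {a b} → T (adjᵇ C a b) → T (adjᵇ D a b)
  adjᵇ-mono C⊆D {inj₁ i} {inj₂ j} = C⊆D i j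
  adjᵇ-mono C⊆D {inj₂ j} {inj₁ i} = C⊆D i j

  record UnitCurrent (C : Graph) (s t : V) (x : V → ℚ) : Set where
    constructor kirchhoff
    field lap≡ : ∀ w → Lap C x w ≡ δ C s w - δ C t w

  δ-refl : ∀ C (u : V) → δ C u u ≡ 1ℚ
  δ-refl C u with _≟ᵛ_ C u u
  ... | yes _  = refl
  ... | no u≢u = ⊥-elim (u≢u refl)

  δ-≢ : ∀ C {u w : V} → u ≢ w → δ C u w ≡ 0ℚ
  δ-≢ C {u} {w} u≢w with _≟ᵛ_ C u w
  ... | yes u≡w = ⊥-elim (u≢w u≡w)
  ... | no _    = refl

  weighted-δ-off : ∀ C (φ : V → ℚ) {s w} → s ≢ w → φ w * δ C s w ≡ 0ℚ
  weighted-δ-off C φ {w = w} s≢w = trans (cong (φ w *_) (δ-≢ C s≢w)) (*-zeroʳ (φ w))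

  weighted-δ-on : ∀ C (φ : V → ℚ) s → φ s * δ C s s ≡ φ s
  weighted-δ-on C φ s = trans (cong (φ s *_) (δ-refl C s)) (*-identityʳ (φ s))

  sumV-δ : ∀ C (φ : V → ℚ) s → sumV (λ w → φ w * δ C s w) ≡ φ s
  sumV-δ C φ (inj₁ a) =
    trans (cong₂ _+_ (sumFin-single n₁ a (λ k k≢a → weighted-δ-off C φ (k≢a ∘ sym ∘ inj₁-injective)))
                     (sumFin-0 n₂ (λ k → weighted-δ-off C φ {inj₁ a} λ ())))
          (trans (+-identityʳ _) (weighted-δ-on C φ (inj₁ a)))
  sumV-δ C φ (inj₂ a) =
    trans (cong₂ _+_ (sumFin-0 n₁ (λ k → weighted-δ-off C φ {inj₂ a} λ ()))
                     (sumFin-single n₂ a (λ k k≢a → weighted-δ-off C φ (k≢a ∘ sym ∘ inj₂-injective))))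
          (trans (+-identityˡ _) (weighted-δ-on C φ (inj₂ a)))

  energy-unitCurrent : ∀ C {s t x} → UnitCurrent C s t x → ∀ φ → energy C φ x ≡ φ s - φ t
  energy-unitCurrent C {s} {t} {x} (kirchhoff lap≡) φ = begin
    energy C φ x
      ≡⟨ sym (green-identity C φ x) ⟩
    sumV (λ w → φ w * Lap C x w)
      ≡⟨ sumV-cong (λ w → trans (cong (φ w *_) (lap≡ w)) (*-distribˡ-- (φ w) (δ C s w) (δ C t w))) ⟩
    sumV (λ w → φ w * δ C s w - φ w * δ C t w)
      ≡⟨ sumV-- (λ w → φ w * δ C s w) (λ w → φ w * δ C t w) ⟩
    sumV (λ w → φ w * δ C s w) - sumV (λ w → φ w * δ C t w)
      ≡⟨ cong₂ _-_ (sumV-δ C φ s) (sumV-δ C φ t) ⟩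
    φ s - φ t ∎
    where
    open ≡-Reasoning
    *-distribˡ-- : ∀ a b c → a * (b - c) ≡ a * b - a * c
    *-distribˡ-- = solve-∀ ℚ-ring

  dirichlet-principle : ∀ C {s t x} → UnitCurrent C s t x →
    ∀ φ → (φ s - φ t) + (φ s - φ t) - energy C φ φ ≤ x s - x t
  dirichlet-principle C {s} {t} {x} current φ =
    0≤q-p⇒p≤q (subst (0ℚ ≤_) energy-of-difference (sumE-nonneg C (λ i j → 0≤p*p (drop x i j - drop φ i j))))
    where
    open ≡-Reasoning
    expand : ∀ a b → (a - b) * (a - b) ≡ (a * a - b * a) - (b * a - b * b)
    expand = solve-∀ ℚ-ring
    regroup : ∀ ω v e → (ω - v) - (v - e) ≡ ω - (v + v - e)
    regroup = solve-∀ ℚ-ring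
    energy-of-difference :
      sumE C (λ i j → (drop x i j - drop φ i j) * (drop x i j - drop φ i j))
        ≡ x s - x t - ((φ s - φ t) + (φ s - φ t) - energy C φ φ)
    energy-of-difference = begin
      sumE C (λ i j → (drop x i j - drop φ i j) * (drop x i j - drop φ i j))
        ≡⟨ sumE-cong C (λ i j → expand (drop x i j) (drop φ i j)) ⟩
      sumE C (λ i j → (drop x i j * drop x i j - drop φ i j * drop x i j)
                      - (drop φ i j * drop x i j - drop φ i j * drop φ i j))
        ≡⟨ trans (sumE-- C _ _) (cong₂ _-_ (sumE-- C _ _) (sumE-- C _ _)) ⟩
      (energy C x x - energy C φ x) - (energy C φ x - energy C φ φ)
        ≡⟨ cong₂ (λ ω v → (ω - v) - (v - energy C φ φ))
                 (energy-unitCurrent C current x) (energy-unitCurrent C current φ) ⟩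
      (x s - x t - (φ s - φ t)) - ((φ s - φ t) - energy C φ φ)
        ≡⟨ regroup (x s - x t) (φ s - φ t) (energy C φ φ) ⟩
      x s - x t - ((φ s - φ t) + (φ s - φ t) - energy C φ φ) ∎

  term≤sumE : ∀ C {f} → (∀ i j → 0ℚ ≤ f i j) → ∀ i j → C i j ≡ true → f i j ≤ sumE C f
  term≤sumE C {f} 0≤f i j edge =
    subst (_≤ sumE C f) (cong (λ b → guard b (f i j)) edge)
          (term≤sum₂ (λ i j → guard-nonneg (C i j) (λ _ → 0≤f i j)) i j)

  -- The edge alone dissipates ω², at most the total energy ω.
  edge-resistance≤1 : ∀ C {i₀ j₀ x} → C i₀ j₀ ≡ true → UnitCurrent C (inj₁ i₀) (inj₂ j₀) x →
    0ℚ < drop x i₀ j₀ → drop x i₀ j₀ ≤ 1ℚ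
  edge-resistance≤1 C {i₀} {j₀} {x} edge current 0<ω = *-cancelˡ-≤-pos ω {{positive 0<ω}} (begin
    ω * ω          ≤⟨ term≤sumE C (λ i j → 0≤p*p (drop x i j)) i₀ j₀ edge ⟩
    energy C x x   ≡⟨ energy-unitCurrent C current x ⟩
    ω              ≡⟨ sym (*-identityʳ ω) ⟩
    ω * 1ℚ         ∎)
    where
    open ≤-Reasoning
    ω = drop x i₀ j₀

  sumE≤sum₂ : ∀ C {f} → (∀ i j → 0ℚ ≤ f i j) → sumE C f ≤ sum₂ f
  sumE≤sum₂ C 0≤f = sum₂-mono (λ i j → guard-≤ (C i j) (0≤f i j) (λ _ → ≤-refl))

  sumE-complete : ∀ C {f} → (∀ i j → C i j ≡ true) → sumE C f ≡ sum₂ f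
  sumE-complete C {f} complete = sum₂-cong (λ i j → cong (λ b → guard b (f i j)) (complete i j))

  energy-sym : ∀ C φ x → energy C φ x ≡ energy C x φ
  energy-sym C φ x = sumE-cong C (λ i j → *-comm (drop φ i j) (drop x i j))

-- The complete bipartite network K_{n₁,n₂}

module CompleteBipartite {n₁ n₂ : ℕ} (1≤n₁ : 1 ℕ.≤ n₁) (1≤n₂ : 1 ℕ.≤ n₂) where
  open Network {n₁} {n₂}

  K : Graph
  K _ _ = true

  N₁ N₂ a b D y : ℚ
  N₁ = ℕ→ℚ n₁
  N₂ = ℕ→ℚ n₂
  a = inv N₁
  b = inv N₂
  D = N₁ + N₂ - 1ℚ
  y = inv D

  N₁a≡1 : N₁ * a ≡ 1ℚ
  N₁a≡1 = inv-inverseʳ (0<⇒≢0 (0<ℕ→ℚ 1≤n₁))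

  N₂b≡1 : N₂ * b ≡ 1ℚ
  N₂b≡1 = inv-inverseʳ (0<⇒≢0 (0<ℕ→ℚ 1≤n₂))

  0<D : 0ℚ < D
  0<D = subst₂ _<_ (+-identityˡ 0ℚ) (N₁-1+N₂≡D N₁ N₂)
                   (+-mono-≤-< (p≤q⇒0≤q-p (1≤ℕ→ℚ 1≤n₁)) (0<ℕ→ℚ 1≤n₂))
    where
    N₁-1+N₂≡D : ∀ p q → p - 1ℚ + q ≡ p + q - 1ℚ
    N₁-1+N₂≡D = solve-∀ ℚ-ring

  Dy≡1 : D * y ≡ 1ℚ
  Dy≡1 = inv-inverseʳ (0<⇒≢0 0<D)

  -- (n₁ + n₂ − 1)/(n₁n₂), the resistance between adjacent vertices of K_{n₁,n₂}
  rK : ℚ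
  rK = a + b - a * b

  rK≡D*a*b : rK ≡ D * (a * b)
  rK≡D*a*b = begin
    a + b - a * b                     ≡⟨ reorder a b ⟩
    1ℚ * b + 1ℚ * a - a * b           ≡⟨ cong₂ (λ u v → u * b + v * a - a * b)
                                                 (sym N₁a≡1) (sym N₂b≡1) ⟩
    N₁ * a * b + N₂ * b * a - a * b   ≡⟨ factor N₁ N₂ a b ⟩
    D * (a * b)                       ∎
    where
    open ≡-Reasoning
    reorder : ∀ a b → a + b - a * b ≡ 1ℚ * b + 1ℚ * a - a * b
    reorder = solve-∀ ℚ-ring
    factor : ∀ p q a b → p * a * b + q * b * a - a * b ≡ (p + q - 1ℚ) * (a * b)
    factor = solve-∀ ℚ-ring

  0<rK : 0ℚ < rK
  0<rK = subst (0ℚ <_) (sym rK≡D*a*b) (positive⁻¹ _ {{pos*pos⇒pos D (a * b) {{ab-pos}}}})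
    where
    instance
      D-pos : Positive D
      D-pos = positive 0<D
      a-pos : Positive a
      a-pos = positive (inv-pos (0<ℕ→ℚ 1≤n₁))
      b-pos : Positive b
      b-pos = positive (inv-pos (0<ℕ→ℚ 1≤n₂))
    ab-pos : Positive (a * b)
    ab-pos = pos*pos⇒pos a b

  inv-rK : inv rK ≡ N₁ * N₂ * y
  inv-rK = *≡1⇒inv≡ {rK} (begin
    rK * (N₁ * N₂ * y)                 ≡⟨ cong (_* (N₁ * N₂ * y)) rK≡D*a*b ⟩
    D * (a * b) * (N₁ * N₂ * y)        ≡⟨ regroup D a b N₁ N₂ y ⟩
    D * y * ((N₁ * a) * (N₂ * b))      ≡⟨ cong₂ (λ u v → u * v) Dy≡1 (cong₂ _*_ N₁a≡1 N₂b≡1) ⟩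
    1ℚ * (1ℚ * 1ℚ)                     ≡⟨⟩
    1ℚ                                 ∎)
    where
    open ≡-Reasoning
    regroup : ∀ d a b p q y → d * (a * b) * (p * q * y) ≡ d * y * ((p * a) * (q * b))
    regroup = solve-∀ ℚ-ring

  -- the largest possible value of 1/Ω(i,j) − 1
  gap : ℚ
  gap = inv rK - 1ℚ

  gap≡ : gap ≡ (N₁ - 1ℚ) * (N₂ - 1ℚ) * y
  gap≡ = begin
    inv rK - 1ℚ                       ≡⟨ cong₂ _-_ inv-rK (sym Dy≡1) ⟩
    N₁ * N₂ * y - D * y               ≡⟨ factor N₁ N₂ y ⟩
    (N₁ - 1ℚ) * (N₂ - 1ℚ) * y         ∎
    where
    open ≡-Reasoning
    factor : ∀ p q y → p * q * y - (p + q - 1ℚ) * y ≡ (p - 1ℚ) * (q - 1ℚ) * y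
    factor = solve-∀ ℚ-ring

  0≤gap : 0ℚ ≤ gap
  0≤gap = subst (0ℚ ≤_) (sym gap≡)
    (0≤*0≤⇒0≤* (0≤*0≤⇒0≤* (p≤q⇒0≤q-p (1≤ℕ→ℚ 1≤n₁)) (p≤q⇒0≤q-p (1≤ℕ→ℚ 1≤n₂)))
               (<⇒≤ (inv-pos 0<D)))

  gap≡0⇒star : gap ≡ 0ℚ → n₁ ≡ 1 ⊎ n₂ ≡ 1
  gap≡0⇒star gap≡0 with *≡0⇒≡0 _ y (trans (sym gap≡) gap≡0)
  ... | inj₂ y≡0 = ⊥-elim (1≢0 (trans (sym Dy≡1) (trans (cong (D *_) y≡0) (*-zeroʳ D))))
  ... | inj₁ N₁-1*N₂-1≡0 with *≡0⇒≡0 (N₁ - 1ℚ) (N₂ - 1ℚ) N₁-1*N₂-1≡0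
  ...   | inj₁ N₁-1≡0 = inj₁ (ℕ→ℚ≡1⇒≡1 (p-q≡0⇒p≡q N₁-1≡0))
  ...   | inj₂ N₂-1≡0 = inj₂ (ℕ→ℚ≡1⇒≡1 (p-q≡0⇒p≡q N₂-1≡0))

  upperBound≡ : upperBound n₁ n₂ ≡ sum₂ (λ _ _ → gap)
  upperBound≡ = sym (begin
    sum₂ (λ _ _ → gap)                      ≡⟨ sum₂-const gap ⟩
    N₁ * (N₂ * gap)                         ≡⟨ cong (λ g → N₁ * (N₂ * g)) gap≡ ⟩
    N₁ * (N₂ * ((N₁ - 1ℚ) * (N₂ - 1ℚ) * y)) ≡⟨ expand N₁ N₂ y ⟩
    upperBound n₁ n₂                        ∎)
    where
    open ≡-Reasoning
    expand : ∀ p q y → p * (q * ((p - 1ℚ) * (q - 1ℚ) * y)) ≡ p * q * (p * q - p - q + 1ℚ) * y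
    expand = solve-∀ ℚ-ring

  module UnitPotential (i₀ : Fin n₁) (j₀ : Fin n₂) where

    s t : V
    s = inj₁ i₀
    t = inj₂ j₀

    -- the unit-current potential of K_{n₁,n₂}, normalised to vanish on the first part off i₀
    ψ : V → ℚ
    ψ (inj₁ i) = δ K s (inj₁ i) * b
    ψ (inj₂ j) = a * b - δ K t (inj₂ j) * a

    δ-sum : ∀ {m} (u : V) (emb : Fin m → V) c k → (∀ l → l ≢ k → u ≢ emb l) → emb k ≡ u →
      sumFin m (λ l → δ K u (emb l) * c) ≡ c
    δ-sum u emb c k off on =
      trans (sumFin-single _ k (λ l l≢k → trans (cong (_* c) (δ-≢ K (off l l≢k))) (*-zeroˡ c)))
            (trans (cong (λ w → δ K u w * c) on) (trans (cong (_* c) (δ-refl K u)) (*-identityˡ c)))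

    sum-ψ₁ : sumFin n₁ (ψ ∘ inj₁) ≡ b
    sum-ψ₁ = δ-sum s inj₁ b i₀ (λ l l≢i₀ s≡l → l≢i₀ (sym (inj₁-injective s≡l))) refl

    sum-ψ₂ : sumFin n₂ (ψ ∘ inj₂) ≡ N₂ * (a * b) - a
    sum-ψ₂ = trans (sumFin-- n₂ (λ _ → a * b) (λ j → δ K t (inj₂ j) * a))
                   (cong₂ _-_ (sumFin-const n₂ (a * b))
                              (δ-sum t inj₂ a j₀ (λ l l≢j₀ t≡l → l≢j₀ (sym (inj₂-injective t≡l))) refl))

    ψ-unitCurrent : UnitCurrent K s t ψ
    ψ-unitCurrent = kirchhoff lap≡
      where
      lap≡ : ∀ w → Lap K ψ w ≡ δ K s w - δ K t w
      lap≡ (inj₁ i) = begin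
        sumFin n₂ (λ j → ψ (inj₁ i) - ψ (inj₂ j))
          ≡⟨ sumFin-- n₂ (λ _ → ψ (inj₁ i)) (ψ ∘ inj₂) ⟩
        sumFin n₂ (λ _ → ψ (inj₁ i)) - sumFin n₂ (ψ ∘ inj₂)
          ≡⟨ cong₂ _-_ (sumFin-const n₂ (ψ (inj₁ i))) sum-ψ₂ ⟩
        N₂ * (d * b) - (N₂ * (a * b) - a)
          ≡⟨ regroup N₂ d a b ⟩
        d * (N₂ * b) - a * (N₂ * b) + a
          ≡⟨ cong (λ u → d * u - a * u + a) N₂b≡1 ⟩
        d * 1ℚ - a * 1ℚ + a
          ≡⟨ simplify d a ⟩
        d - 0ℚ
          ≡⟨ cong (λ e → d - e) (sym (δ-≢ K {t} {inj₁ i} λ ())) ⟩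
        δ K s (inj₁ i) - δ K t (inj₁ i) ∎
        where
        open ≡-Reasoning
        d = δ K s (inj₁ i)
        regroup : ∀ n d a b → n * (d * b) - (n * (a * b) - a) ≡ d * (n * b) - a * (n * b) + a
        regroup = solve-∀ ℚ-ring
        simplify : ∀ d a → d * 1ℚ - a * 1ℚ + a ≡ d - 0ℚ
        simplify = solve-∀ ℚ-ring
      lap≡ (inj₂ j) = begin
        sumFin n₁ (λ i → ψ (inj₂ j) - ψ (inj₁ i))
          ≡⟨ sumFin-- n₁ (λ _ → ψ (inj₂ j)) (ψ ∘ inj₁) ⟩
        sumFin n₁ (λ _ → ψ (inj₂ j)) - sumFin n₁ (ψ ∘ inj₁)
          ≡⟨ cong₂ _-_ (sumFin-const n₁ (ψ (inj₂ j))) sum-ψ₁ ⟩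
        N₁ * (a * b - d * a) - b
          ≡⟨ regroup N₁ d a b ⟩
        (N₁ * a) * b - d * (N₁ * a) - b
          ≡⟨ cong (λ u → u * b - d * u - b) N₁a≡1 ⟩
        1ℚ * b - d * 1ℚ - b
          ≡⟨ simplify d b ⟩
        0ℚ - d
          ≡⟨ cong (_- d) (sym (δ-≢ K {s} {inj₂ j} λ ())) ⟩
        δ K s (inj₂ j) - δ K t (inj₂ j) ∎
        where
        open ≡-Reasoning
        d = δ K t (inj₂ j)
        regroup : ∀ n d a b → n * (a * b - d * a) - b ≡ (n * a) * b - d * (n * a) - b
        regroup = solve-∀ ℚ-ring
        simplify : ∀ d b → 1ℚ * b - d * 1ℚ - b ≡ 0ℚ - d
        simplify = solve-∀ ℚ-ring

    ψs-ψt≡rK : ψ s - ψ t ≡ rK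
    ψs-ψt≡rK = begin
      δ K s s * b - (a * b - δ K t t * a)
        ≡⟨ cong₂ (λ u v → u * b - (a * b - v * a)) (δ-refl K s) (δ-refl K t) ⟩
      1ℚ * b - (a * b - 1ℚ * a)
        ≡⟨ regroup a b ⟩
      rK ∎
      where
      open ≡-Reasoning
      regroup : ∀ a b → 1ℚ * b - (a * b - 1ℚ * a) ≡ a + b - a * b
      regroup = solve-∀ ℚ-ring

  -- Rayleigh monotonicity: removing edges from K_{n₁,n₂} cannot decrease resistances.
  rK≤resistance : ∀ C {i₀ j₀ x} → UnitCurrent C (inj₁ i₀) (inj₂ j₀) x →
    rK ≤ x (inj₁ i₀) - x (inj₂ j₀)
  rK≤resistance C {i₀} {j₀} current = ≤-trans rK≤ (dirichlet-principle C current ψ)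
    where
    open UnitPotential i₀ j₀
    open ≤-Reasoning
    rK≤ : rK ≤ (ψ s - ψ t) + (ψ s - ψ t) - energy C ψ ψ
    rK≤ = begin
      rK                                          ≡⟨ r≡r+r-r rK ⟩
      rK + rK - rK                                ≡⟨ cong₂ (λ r e → r + r - e) (sym ψs-ψt≡rK) (sym energy-ψ) ⟩
      (ψ s - ψ t) + (ψ s - ψ t) - energy K ψ ψ    ≤⟨ +-monoʳ-≤ ((ψ s - ψ t) + (ψ s - ψ t))
                                                                 (neg-antimono-≤ energy-C≤energy-K) ⟩
      (ψ s - ψ t) + (ψ s - ψ t) - energy C ψ ψ    ∎
      where
      r≡r+r-r : ∀ r → r ≡ r + r - r
      r≡r+r-r = solve-∀ ℚ-ring
      energy-ψ : energy K ψ ψ ≡ rK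
      energy-ψ = trans (energy-unitCurrent K ψ-unitCurrent ψ) ψs-ψt≡rK
      energy-C≤energy-K : energy C ψ ψ ≤ energy K ψ ψ
      energy-C≤energy-K = sumE≤sum₂ C (λ i j → 0≤p*p (drop ψ i j))

  complete⇒resistance≡rK : ∀ C {i₀ j₀ x} → (∀ i j → C i j ≡ true) →
    UnitCurrent C (inj₁ i₀) (inj₂ j₀) x → x (inj₁ i₀) - x (inj₂ j₀) ≡ rK
  complete⇒resistance≡rK C {i₀} {j₀} {x} complete current = begin
    x s - x t          ≡⟨ sym (energy-unitCurrent K ψ-unitCurrent x) ⟩
    energy K x ψ       ≡⟨ energy-sym K x ψ ⟩
    energy K ψ x       ≡⟨ sym (sumE-complete C complete) ⟩
    energy C ψ x       ≡⟨ energy-unitCurrent C current ψ ⟩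
    ψ s - ψ t          ≡⟨ ψs-ψt≡rK ⟩
    rK                 ∎
    where
    open UnitPotential i₀ j₀
    open ≡-Reasoning

-- Reachability in a finite graph

_⊆ᵇ_ : {A : Set} → (A → Bool) → (A → Bool) → Set
p ⊆ᵇ q = ∀ a → T (p a) → T (q a)

bit : Bool → ℕ
bit b = if b then 1 else 0

bit-mono : ∀ {b c} → (T b → T c) → bit b ℕ.≤ bit c
bit-mono {false}         b⇒c = z≤n
bit-mono {true}  {true}  b⇒c = ℕ.≤-refl
bit-mono {true}  {false} b⇒c = ⊥-elim (b⇒c _)

bit-mono-≡ : ∀ {b c} → (T b → T c) → bit c ℕ.≤ bit b → c ≡ b
bit-mono-≡ {true}  {true}  b⇒c c≤b = refl
bit-mono-≡ {true}  {false} b⇒c c≤b = ⊥-elim (b⇒c _)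
bit-mono-≡ {false} {true}  b⇒c ()
bit-mono-≡ {false} {false} b⇒c c≤b = refl

+-mono-≤-reflect : ∀ {a b c d} → a ℕ.+ b ℕ.≤ c ℕ.+ d → c ℕ.≤ a → d ℕ.≤ b →
  a ℕ.≤ c × b ℕ.≤ d
+-mono-≤-reflect {a} {b} {c} {d} ab≤cd c≤a d≤b =
  ℕ.+-cancelʳ-≤ b a c (ℕ.≤-trans ab≤cd (ℕ.+-monoʳ-≤ c d≤b)) ,
  ℕ.+-cancelˡ-≤ a b d (ℕ.≤-trans ab≤cd (ℕ.+-monoˡ-≤ d c≤a))

count : ∀ n → (Fin n → Bool) → ℕ
count zero    p = 0
count (suc n) p = bit (p fzero) ℕ.+ count n (p ∘ fsuc)

bit≤1 : ∀ b → bit b ℕ.≤ 1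
bit≤1 false = z≤n
bit≤1 true  = ℕ.≤-refl

count≤n : ∀ n p → count n p ℕ.≤ n
count≤n zero    p = z≤n
count≤n (suc n) p = ℕ.+-mono-≤ (bit≤1 (p fzero)) (count≤n n (p ∘ fsuc))

count-mono : ∀ n {p q} → p ⊆ᵇ q → count n p ℕ.≤ count n q
count-mono zero    p⊆q = z≤n
count-mono (suc n) p⊆q = ℕ.+-mono-≤ (bit-mono (p⊆q fzero)) (count-mono n (p⊆q ∘ fsuc))

count-mono-≡ : ∀ n {p q} → p ⊆ᵇ q → count n q ℕ.≤ count n p → ∀ k → q k ≡ p k
count-mono-≡ (suc n) p⊆q q≤p k
  with +-mono-≤-reflect q≤p (bit-mono (p⊆q fzero)) (count-mono n (p⊆q ∘ fsuc))
count-mono-≡ (suc n) p⊆q q≤p fzero    | q₀≤p₀ , _ = bit-mono-≡ (p⊆q fzero) q₀≤p₀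
count-mono-≡ (suc n) p⊆q q≤p (fsuc k) | _ , qₛ≤pₛ = count-mono-≡ n (p⊆q ∘ fsuc) qₛ≤pₛ k

anyFin : ∀ n → (Fin n → Bool) → Bool
anyFin zero    p = false
anyFin (suc n) p = p fzero ∨ anyFin n (p ∘ fsuc)

anyFin-sound : ∀ n p → T (anyFin n p) → Σ (Fin n) (T ∘ p)
anyFin-sound (suc n) p any-p with Equivalence.to T-∨ any-p
... | inj₁ p₀ = fzero , p₀
... | inj₂ any-pₛ with anyFin-sound n (p ∘ fsuc) any-pₛ
...   | k , pₖ = fsuc k , pₖ

anyFin-complete : ∀ n p k → T (p k) → T (anyFin n p)
anyFin-complete (suc n) p fzero    pₖ = Equivalence.from T-∨ (inj₁ pₖ)
anyFin-complete (suc n) p (fsuc k) pₖ = Equivalence.from T-∨ (inj₂ (anyFin-complete n (p ∘ fsuc) k pₖ))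

anyFin-cong : ∀ n {p q} → (∀ k → p k ≡ q k) → anyFin n p ≡ anyFin n q
anyFin-cong zero    p≗q = refl
anyFin-cong (suc n) p≗q = cong₂ _∨_ (p≗q fzero) (anyFin-cong n (p≗q ∘ fsuc))

lastOf : {A : Set} → A → List A → A
lastOf a []      = a
lastOf a (b ∷ l) = lastOf b l

All-lastOf : {A : Set} {P : A → Set} → ∀ a l → All P (a ∷ l) → P (lastOf a l)
All-lastOf a []      (pa ∷ [])  = pa
All-lastOf a (b ∷ l) (_ ∷ all-p) = All-lastOf b l all-p

T-injective : ∀ {b c} → (T b → T c) → (T c → T b) → b ≡ c
T-injective {false} {false} b⇒c c⇒b = refl
T-injective {false} {true}  b⇒c c⇒b = ⊥-elim (c⇒b _)
T-injective {true}  {false} b⇒c c⇒b = ⊥-elim (b⇒c _)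
T-injective {true}  {true}  b⇒c c⇒b = refl

¬T⇒≡false : ∀ {b} → ¬ T b → b ≡ false
¬T⇒≡false {false} ¬b = refl
¬T⇒≡false {true}  ¬b = ⊥-elim (¬b _)

module Reachability {n₁ n₂ : ℕ} (E : Vtx n₁ n₂ → Vtx n₁ n₂ → Bool) (root : Vtx n₁ n₂) where
  open Network {n₁} {n₂} using (V)

  anyV : (V → Bool) → Bool
  anyV p = anyFin n₁ (p ∘ inj₁) ∨ anyFin n₂ (p ∘ inj₂)

  anyV-sound : ∀ p → T (anyV p) → Σ V (T ∘ p)
  anyV-sound p any-p with Equivalence.to T-∨ any-p
  ... | inj₁ any₁ = let k , pₖ = anyFin-sound n₁ (p ∘ inj₁) any₁ in inj₁ k , pₖ
  ... | inj₂ any₂ = let k , pₖ = anyFin-sound n₂ (p ∘ inj₂) any₂ in inj₂ k , pₖ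

  anyV-complete : ∀ p w → T (p w) → T (anyV p)
  anyV-complete p (inj₁ k) pₖ = Equivalence.from T-∨ (inj₁ (anyFin-complete n₁ (p ∘ inj₁) k pₖ))
  anyV-complete p (inj₂ k) pₖ = Equivalence.from T-∨ (inj₂ (anyFin-complete n₂ (p ∘ inj₂) k pₖ))

  anyV-cong : ∀ {p q} → (∀ w → p w ≡ q w) → anyV p ≡ anyV q
  anyV-cong p≗q = cong₂ _∨_ (anyFin-cong n₁ (p≗q ∘ inj₁)) (anyFin-cong n₂ (p≗q ∘ inj₂))

  countV : (V → Bool) → ℕ
  countV p = count n₁ (p ∘ inj₁) ℕ.+ count n₂ (p ∘ inj₂)

  countV≤ : ∀ p → countV p ℕ.≤ n₁ ℕ.+ n₂
  countV≤ p = ℕ.+-mono-≤ (count≤n n₁ _) (count≤n n₂ _)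

  countV-mono-≡ : ∀ {p q} → p ⊆ᵇ q → countV q ℕ.≤ countV p → ∀ w → q w ≡ p w
  countV-mono-≡ p⊆q q≤p w
    with +-mono-≤-reflect q≤p (count-mono n₁ (p⊆q ∘ inj₁)) (count-mono n₂ (p⊆q ∘ inj₂))
  countV-mono-≡ p⊆q q≤p (inj₁ k) | q₁≤p₁ , _ = count-mono-≡ n₁ (p⊆q ∘ inj₁) q₁≤p₁ k
  countV-mono-≡ p⊆q q≤p (inj₂ k) | _ , q₂≤p₂ = count-mono-≡ n₂ (p⊆q ∘ inj₂) q₂≤p₂ k

  reach : ℕ → V → Bool
  reach zero    w = isYes (≡-dec Fin._≟_ Fin._≟_ w root)
  reach (suc k) w = reach k w ∨ anyV (λ z → E w z ∧ reach k z)

  reach-inflationary : ∀ k → reach k ⊆ᵇ reach (suc k)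
  reach-inflationary k w reached =
    Equivalence.from (T-∨ {reach k w} {anyV (λ z → E w z ∧ reach k z)}) (inj₁ reached)

  Stable : ℕ → Set
  Stable k = ∀ w → reach (suc k) w ≡ reach k w

  stable-suc : ∀ k → Stable k → Stable (suc k)
  stable-suc k stable w = cong₂ _∨_ (stable w) (anyV-cong (λ z → cong (E w z ∧_) (stable z)))

  -- Each unstable step adds a vertex, which can happen at most n₁ + n₂ times.
  stable-or-growing : ∀ m → Stable m ⊎ m ℕ.≤ countV (reach m)
  stable-or-growing zero = inj₂ z≤n
  stable-or-growing (suc m) with stable-or-growing m
  ... | inj₁ stable = inj₁ (stable-suc m stable)
  ... | inj₂ m≤count with countV (reach (suc m)) ℕ.≤? countV (reach m)
  ...   | yes no-growth = inj₁ (stable-suc m (countV-mono-≡ (reach-inflationary m) no-growth))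
  ...   | no growth = inj₂ (ℕ.≤-trans (s≤s m≤count) (ℕ.≰⇒> growth))

  bound : ℕ
  bound = suc (n₁ ℕ.+ n₂)

  stable : Stable bound
  stable with stable-or-growing bound
  ... | inj₁ stable = stable
  ... | inj₂ bound≤count = ⊥-elim (ℕ.<-irrefl refl (ℕ.≤-trans bound≤count (countV≤ (reach bound))))

  reachable : V → Bool
  reachable = reach bound

  reachable-closed : ∀ {w w′} → T (reachable w) → T (E w′ w) → T (reachable w′)
  reachable-closed {w} {w′} reached edge = subst T (stable w′)
    (Equivalence.from (T-∨ {reachable w′} {anyV neighbour-reachable}) (inj₂ (anyV-complete neighbour-reachable w
      (Equivalence.from (T-∧ {E w′ w} {reachable w}) (edge , reached)))))
    where
    neighbour-reachable : V → Bool
    neighbour-reachable z = E w′ z ∧ reachable z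

  reach-root : ∀ k → T (reach k root)
  reach-root zero    = fromWitness refl
  reach-root (suc k) = reach-inflationary k root (reach-root k)

  reachable-root : T (reachable root)
  reachable-root = reach-root bound

  EChain : V → List V → Set
  EChain a []      = ⊤
  EChain a (b ∷ l) = T (E a b) × EChain b l

  -- l lists the vertices after w
  SimplePath : V → Set
  SimplePath w = Σ (List V) λ l → EChain w l × Unique (w ∷ l) × lastOf w l ≡ root

  shortcut : ∀ {w z l} → Any (w ≡_) (z ∷ l) →
    EChain z l → Unique (z ∷ l) → lastOf z l ≡ root → SimplePath w
  shortcut (here refl) chain unique end = _ , chain , unique , end
  shortcut {l = _ ∷ _} (there w∈l) (_ , chain) (_ ∷ unique) end = shortcut w∈l chain unique end

  extend : ∀ {w z} → T (E w z) → SimplePath z → SimplePath w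
  extend {w} {z} edge (l , chain , unique , end) with any? (≡-dec Fin._≟_ Fin._≟_ w) (z ∷ l)
  ... | yes w∈z∷l = shortcut w∈z∷l chain unique end
  ... | no  w∉z∷l = z ∷ l , (edge , chain) , ¬Any⇒All¬ (z ∷ l) w∉z∷l ∷ unique , end

  reach⇒simplePath : ∀ k {w} → T (reach k w) → SimplePath w
  reach⇒simplePath zero is-root with toWitness is-root
  ... | refl = [] , _ , [] ∷ [] , refl
  reach⇒simplePath (suc k) {w} reached
    with Equivalence.to (T-∨ {reach k w} {anyV (λ z → E w z ∧ reach k z)}) reached
  ... | inj₁ reached-sooner = reach⇒simplePath k reached-sooner
  ... | inj₂ via-neighbour with anyV-sound (λ z → E w z ∧ reach k z) via-neighbour
  ...   | z , edge∧reached with Equivalence.to (T-∧ {E w z} {reach k z}) edge∧reached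
  ...     | edge , reached-z = extend edge (reach⇒simplePath k reached-z)

star⇒complete : ∀ {n₁ n₂} {B : Fin n₁ → Fin n₂ → Bool} →
  Connected B → n₁ ≡ 1 ⊎ n₂ ≡ 1 → IsComplete B
star⇒complete {B = B} connected (inj₁ refl) fzero j = first-step (connected (inj₂ j) (inj₁ fzero))
  where
  first-step : Reach B (inj₂ j) (inj₁ fzero) → B fzero j ≡ true
  first-step (step {w = inj₁ fzero} adj _) = Equivalence.to T-≡ adj
  first-step (step {w = inj₂ _} () _)
star⇒complete {B = B} connected (inj₂ refl) i fzero = first-step (connected (inj₁ i) (inj₂ fzero))
  where
  first-step : Reach B (inj₁ i) (inj₂ fzero) → B i fzero ≡ true
  first-step (step {w = inj₂ fzero} adj _) = Equivalence.to T-≡ adj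
  first-step (step {w = inj₁ _} () _)

module Walks {n₁ n₂ : ℕ} (B : Fin n₁ → Fin n₂ → Bool) where
  open Network {n₁} {n₂} using (V)

  FlatOffEdge : (V → ℚ) → V → V → Set
  FlatOffEdge x u v = ∀ a b → Adj B a b → ¬ ((a ≡ u × b ≡ v) ⊎ (a ≡ v × b ≡ u)) → x a ≡ x b

  FlatOffEdge-sym : ∀ {x u v} → FlatOffEdge x u v → FlatOffEdge x v u
  FlatOffEdge-sym flat a b adj ¬uv = flat a b adj (¬uv ∘ swap)

  -- A walk to u that meets u only at its end and does not end with the step v → u avoids {u, v}.
  walk-flat : ∀ {x u v} → FlatOffEdge x u v →
    ∀ a l → Chain B (a ∷ l ++ u ∷ []) → All (u ≢_) (a ∷ l) → lastOf a l ≢ v → x a ≡ x u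
  walk-flat flat a [] (a~u , _) (u≢a ∷ []) a≢v = flat a _ a~u not-uv
    where
    not-uv : ¬ ((a ≡ _ × _ ≡ _) ⊎ (a ≡ _ × _ ≡ _))
    not-uv (inj₁ (a≡u , _)) = u≢a (sym a≡u)
    not-uv (inj₂ (a≡v , _)) = a≢v a≡v
  walk-flat flat a (b ∷ l) (a~b , chain) (u≢a ∷ u≢b ∷ u∉l) last≢v =
    trans (flat a b a~b not-uv) (walk-flat flat b l chain (u≢b ∷ u∉l) last≢v)
    where
    not-uv : ¬ ((a ≡ _ × b ≡ _) ⊎ (a ≡ _ × b ≡ _))
    not-uv (inj₁ (a≡u , _)) = u≢a (sym a≡u)
    not-uv (inj₂ (_ , b≡u)) = u≢b (sym b≡u)

-- Resistances of the edges of a bipartite graph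

module Resistances {n₁ n₂ : ℕ} (1≤n₁ : 1 ℕ.≤ n₁) (1≤n₂ : 1 ℕ.≤ n₂)
                   (B : Fin n₁ → Fin n₂ → Bool) (Ω : Vtx n₁ n₂ → Vtx n₁ n₂ → ℚ)
                   (isΩ : IsResistanceDistance B Ω) where
  open Network {n₁} {n₂}
  open CompleteBipartite 1≤n₁ 1≤n₂

  potential : Fin n₁ → Fin n₂ → V → ℚ
  potential i j = proj₁ (isΩ (inj₁ i) (inj₂ j))

  potential-unitCurrent : ∀ i j → UnitCurrent B (inj₁ i) (inj₂ j) (potential i j)
  potential-unitCurrent i j = kirchhoff (proj₁ (proj₂ (isΩ (inj₁ i) (inj₂ j))))

  R : Fin n₁ → Fin n₂ → ℚ
  R i j = Ω (inj₁ i) (inj₂ j)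

  R≡drop : ∀ i j → R i j ≡ drop (potential i j) i j
  R≡drop i j = proj₂ (proj₂ (isΩ (inj₁ i) (inj₂ j)))

  rK≤R : ∀ i j → rK ≤ R i j
  rK≤R i j = subst (rK ≤_) (sym (R≡drop i j)) (rK≤resistance B (potential-unitCurrent i j))

  0<R : ∀ i j → 0ℚ < R i j
  0<R i j = <-≤-trans 0<rK (rK≤R i j)

  R≤1 : ∀ i j → B i j ≡ true → R i j ≤ 1ℚ
  R≤1 i j edge = subst (_≤ 1ℚ) (sym (R≡drop i j))
    (edge-resistance≤1 B edge (potential-unitCurrent i j) (subst (0ℚ <_) (R≡drop i j) (0<R i j)))

  term : Fin n₁ → Fin n₂ → ℚ
  term i j = guard (B i j) (inv (R i j) - 1ℚ)

  0≤term : ∀ i j → 0ℚ ≤ term i j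
  0≤term i j = guard-nonneg (B i j) (λ edge → p≤q⇒0≤q-p (inv-antimono (0<R i j) (R≤1 i j edge)))

  term≤gap : ∀ i j → term i j ≤ gap
  term≤gap i j = guard-≤ (B i j) 0≤gap (λ _ → +-monoˡ-≤ (- 1ℚ) (inv-antimono 0<rK (rK≤R i j)))

  0≤cyclicity : 0ℚ ≤ cyclicity B Ω
  0≤cyclicity = sum₂-nonneg 0≤term

  cyclicity≤upperBound : cyclicity B Ω ≤ upperBound n₁ n₂
  cyclicity≤upperBound = subst (cyclicity B Ω ≤_) (sym upperBound≡) (sum₂-mono term≤gap)

  complete⇒cyclicity≡upperBound : IsComplete B → cyclicity B Ω ≡ upperBound n₁ n₂
  complete⇒cyclicity≡upperBound complete = trans (sum₂-cong term≡gap) (sym upperBound≡)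
    where
    R≡rK : ∀ i j → R i j ≡ rK
    R≡rK i j = trans (R≡drop i j) (complete⇒resistance≡rK B complete (potential-unitCurrent i j))
    term≡gap : ∀ i j → term i j ≡ gap
    term≡gap i j = trans (cong (λ b → guard b (inv (R i j) - 1ℚ)) (complete i j))
                         (cong (λ r → inv r - 1ℚ) (R≡rK i j))

  cyclicity≡upperBound⇒complete : Connected B → cyclicity B Ω ≡ upperBound n₁ n₂ → IsComplete B
  cyclicity≡upperBound⇒complete connected C≡UB i j with B i j in edge
  ... | true  = refl
  ... | false = trans (sym edge) (star⇒complete connected (gap≡0⇒star gap≡0) i j)
    where
    -- equality forces every term to be gap, including the 0 of the missing edge
    gap≡0 : gap ≡ 0ℚ
    gap≡0 = trans (sym (sum₂-mono-≡ term≤gap (trans C≡UB upperBound≡) i j))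
                  (cong (λ b → guard b (inv (R i j) - 1ℚ)) edge)

  cyclicity≡0⇒unitResistances : cyclicity B Ω ≡ 0ℚ → ∀ i j → B i j ≡ true → R i j ≡ 1ℚ
  cyclicity≡0⇒unitResistances C≡0 i j edge = inv≡1⇒≡1 (p-q≡0⇒p≡q (begin
    inv (R i j) - 1ℚ   ≡⟨ cong (λ b → guard b (inv (R i j) - 1ℚ)) (sym edge) ⟩
    term i j           ≡⟨ sym (sum₂-mono-≡ 0≤term (trans sum₂-0 (sym C≡0)) i j) ⟩
    0ℚ                 ∎))
    where
    open ≡-Reasoning
    sum₂-0 : sum₂ (λ _ _ → 0ℚ) ≡ 0ℚ
    sum₂-0 = sumFin-0 n₁ (λ _ → sumFin-0 n₂ (λ _ → refl))

  unitResistances⇒cyclicity≡0 : (∀ i j → B i j ≡ true → R i j ≡ 1ℚ) → cyclicity B Ω ≡ 0ℚ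
  unitResistances⇒cyclicity≡0 R≡1 = sumFin-0 n₁ (λ i → sumFin-0 n₂ (term≡0 i))
    where
    term≡0 : ∀ i j → guard (B i j) (inv (R i j) - 1ℚ) ≡ 0ℚ
    term≡0 i j with B i j in edge
    ... | true  = trans (cong (λ r → inv r - 1ℚ) (R≡1 i j edge)) (+-inverseʳ 1ℚ)
    ... | false = refl

  other-drops≡0 : ∀ {i₀ j₀} → B i₀ j₀ ≡ true → R i₀ j₀ ≡ 1ℚ →
    ∀ i j → B i j ≡ true → ¬ (i₀ ≡ i × j₀ ≡ j) → drop (potential i₀ j₀) i j ≡ 0ℚ
  other-drops≡0 {i₀} {j₀} edge₀ R₀≡1 i j edge distinct =
    p*p≡0⇒p≡0 (drop x i j) (≤-antisym square≤0 (0≤p*p (drop x i j)))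
    where
    x = potential i₀ j₀
    square : Fin n₁ → Fin n₂ → ℚ
    square i j = drop x i j * drop x i j
    drop₀≡1 : drop x i₀ j₀ ≡ 1ℚ
    drop₀≡1 = trans (sym (R≡drop i₀ j₀)) R₀≡1
    energy≡1 : energy B x x ≡ 1ℚ
    energy≡1 = trans (energy-unitCurrent B (potential-unitCurrent i₀ j₀) x) drop₀≡1
    on-edge₀ : guard (B i₀ j₀) (square i₀ j₀) ≡ 1ℚ
    on-edge₀ = trans (cong (λ b → guard b (square i₀ j₀)) edge₀) (cong₂ _*_ drop₀≡1 drop₀≡1)
    1+square≤1 : 1ℚ + square i j ≤ 1ℚ
    1+square≤1 = subst₂ (λ u v → u + v ≤ 1ℚ) on-edge₀ (cong (λ b → guard b (square i j)) edge)
      (≤-trans (pair≤sum₂ (λ i j → guard-nonneg (B i j) (λ _ → 0≤p*p (drop x i j))) distinct)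
               (≤-reflexive energy≡1))
    square≤0 : square i j ≤ 0ℚ
    square≤0 = subst₂ _≤_ (1+p-1≡p (square i j)) (+-inverseʳ 1ℚ) (+-monoˡ-≤ (- 1ℚ) 1+square≤1)
      where
      1+p-1≡p : ∀ p → 1ℚ + p - 1ℚ ≡ p
      1+p-1≡p = solve-∀ ℚ-ring

  open Walks B

  unitResistance⇒flat : ∀ {i₀ j₀} → B i₀ j₀ ≡ true → R i₀ j₀ ≡ 1ℚ →
    FlatOffEdge (potential i₀ j₀) (inj₁ i₀) (inj₂ j₀)
  unitResistance⇒flat edge₀ R₀≡1 (inj₁ i) (inj₂ j) adj not-edge₀ =
    p-q≡0⇒p≡q (other-drops≡0 edge₀ R₀≡1 i j (Equivalence.to T-≡ adj)
                 λ { (refl , refl) → not-edge₀ (inj₁ (refl , refl)) })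
  unitResistance⇒flat edge₀ R₀≡1 (inj₂ j) (inj₁ i) adj not-edge₀ =
    sym (p-q≡0⇒p≡q (other-drops≡0 edge₀ R₀≡1 i j (Equivalence.to T-≡ adj)
                      λ { (refl , refl) → not-edge₀ (inj₂ (refl , refl)) }))

  -- On a cycle through the edge {i, j} the potential would not drop across {i, j}.
  unitResistances⇒acyclic : (∀ i j → B i j ≡ true → R i j ≡ 1ℚ) → Acyclic B
  unitResistances⇒acyclic R≡1 v []           (() , _)
  unitResistances⇒acyclic R≡1 v (w ∷ [])     (s≤s () , _)
  unitResistances⇒acyclic R≡1 v (w ∷ w′ ∷ l) (_ , (v∉ ∷ w∉ ∷ _) , (v~w , chain)) =
    closes v w v~w v∉ chain (λ last≡w → All-lastOf w′ l w∉ (sym last≡w))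
    where
    no-drop : ∀ i j → B i j ≡ true → potential i j (inj₁ i) ≢ potential i j (inj₂ j)
    no-drop i j edge xᵢ≡xⱼ =
      1≢0 (trans (sym (R≡1 i j edge)) (trans (R≡drop i j) (trans (cong (_- xⱼ) xᵢ≡xⱼ) (+-inverseʳ xⱼ))))
      where xⱼ = potential i j (inj₂ j)
    closes : ∀ v w → Adj B v w → All (v ≢_) (w ∷ w′ ∷ l) → Chain B (w ∷ (w′ ∷ l) ++ v ∷ []) →
      lastOf w (w′ ∷ l) ≢ w → ⊥
    closes (inj₁ i) (inj₂ j) adj v∉ chain last≢w = no-drop i j edge
      (sym (walk-flat (unitResistance⇒flat edge (R≡1 i j edge)) _ (w′ ∷ l) chain v∉ last≢w))
      where edge = Equivalence.to T-≡ adj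
    closes (inj₂ j) (inj₁ i) adj v∉ chain last≢w = no-drop i j edge
      (walk-flat (FlatOffEdge-sym (unitResistance⇒flat edge (R≡1 i j edge))) _ (w′ ∷ l) chain v∉ last≢w)
      where edge = Equivalence.to T-≡ adj

  -- In a forest, the vertices reachable from i₀ without the edge {i₀, j₀} form a cut
  -- crossed by that edge alone; its indicator function shows that the edge has resistance 1.
  module CutAtEdge (acyclic : Acyclic B) {i₀ : Fin n₁} {j₀ : Fin n₂} (edge₀ : B i₀ j₀ ≡ true) where

    s t : V
    s = inj₁ i₀
    t = inj₂ j₀

    deleted : Fin n₁ → Fin n₂ → Bool
    deleted i j = isYes (i Fin.≟ i₀) ∧ isYes (j Fin.≟ j₀)

    B⁻ : Graph
    B⁻ i j = B i j ∧ not (deleted i j)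

    B⁻⊆B : ∀ i j → T (B⁻ i j) → T (B i j)
    B⁻⊆B i j = proj₁ ∘ Equivalence.to (T-∧ {B i j})

    B⇒B⁻ : ∀ {i j} → T (B i j) → ¬ (i ≡ i₀ × j ≡ j₀) → T (B⁻ i j)
    B⇒B⁻ {i} {j} adj distinct = Equivalence.from T-∧ (adj , Equivalence.from T-not-≡ (¬T⇒≡false not-deleted))
      where
      not-deleted : ¬ T (deleted i j)
      not-deleted del = let i≡ , j≡ = Equivalence.to (T-∧ {isYes (i Fin.≟ i₀)}) del
                        in distinct (toWitness i≡ , toWitness j≡)

    ¬B⁻-deleted : ¬ T (B⁻ i₀ j₀)
    ¬B⁻-deleted adj
      with Equivalence.to (T-not-≡ {deleted i₀ j₀}) (proj₂ (Equivalence.to (T-∧ {B i₀ j₀}) adj))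
    ... | del≡false = subst T del≡false
      (Equivalence.from (T-∧ {isYes (i₀ Fin.≟ i₀)} {isYes (j₀ Fin.≟ j₀)})
                        (fromWitness {a? = i₀ Fin.≟ i₀} refl , fromWitness {a? = j₀ Fin.≟ j₀} refl))

    open Reachability (adjᵇ B⁻) s

    chain-close : ∀ {a} l {z} → EChain a l → Adj B (lastOf a l) z → Chain B (a ∷ l ++ z ∷ [])
    chain-close []      _           adj = adj , _
    chain-close {a} (b ∷ l) (ab , chain) adj =
      adjᵇ⇒Adj B {a} {b} (adjᵇ-mono B⁻⊆B {a} {b} ab) , chain-close l chain adj

    path-length : ∀ l → EChain t l → lastOf t l ≡ s → 2 ℕ.≤ length l
    path-length []          _        ()
    path-length (_ ∷ [])    (ts , _) refl = ⊥-elim (¬B⁻-deleted ts)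
    path-length (_ ∷ _ ∷ _) _        _    = s≤s (s≤s z≤n)

    t-unreachable : ¬ T (reachable t)
    t-unreachable reached with reach⇒simplePath bound reached
    ... | l , chain , unique , end =
      acyclic t l (path-length l chain end , unique ,
                   chain-close l chain (subst (λ w → Adj B w t) (sym end) (Equivalence.from T-≡ edge₀)))

    reachable-edge : ∀ {i j} → T (B i j) → ¬ (i ≡ i₀ × j ≡ j₀) →
      reachable (inj₁ i) ≡ reachable (inj₂ j)
    reachable-edge adj distinct = T-injective (λ r → reachable-closed r B⁻-edge) (λ r → reachable-closed r B⁻-edge)
      where B⁻-edge = B⇒B⁻ adj distinct

    φ : V → ℚ
    φ w = guard (reachable w) 1ℚ

    φs-φt≡1 : φ s - φ t ≡ 1ℚ
    φs-φt≡1 = cong₂ (λ b c → guard b 1ℚ - guard c 1ℚ)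
                    (Equivalence.to T-≡ reachable-root) (¬T⇒≡false t-unreachable)

    energy-φ : energy B φ φ ≡ 1ℚ
    energy-φ = trans (sum₂-single i₀ j₀ off-edge₀)
                     (trans (cong (λ b → guard b (drop φ i₀ j₀ * drop φ i₀ j₀)) edge₀)
                            (cong (λ d → d * d) φs-φt≡1))
      where
      off-edge₀ : ∀ i j → ¬ (i ≡ i₀ × j ≡ j₀) → guard (B i j) (drop φ i j * drop φ i j) ≡ 0ℚ
      off-edge₀ i j distinct with B i j in edge
      ... | false = refl
      ... | true  = cong (λ d → d * d) (trans (cong (λ b → guard b 1ℚ - φ (inj₂ j))
                                                    (reachable-edge (Equivalence.from T-≡ edge) distinct))
                                              (+-inverseʳ (φ (inj₂ j))))

    R≡1 : R i₀ j₀ ≡ 1ℚ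
    R≡1 = ≤-antisym (R≤1 i₀ j₀ edge₀) (subst₂ _≤_ two-minus-one (sym (R≡drop i₀ j₀))
            (dirichlet-principle B (potential-unitCurrent i₀ j₀) φ))
      where
      two-minus-one : (φ s - φ t) + (φ s - φ t) - energy B φ φ ≡ 1ℚ
      two-minus-one = cong₂ (λ d e → d + d - e) φs-φt≡1 energy-φ

  acyclic⇒unitResistances : Acyclic B → ∀ i j → B i j ≡ true → R i j ≡ 1ℚ
  acyclic⇒unitResistances acyclic i j edge = CutAtEdge.R≡1 acyclic edge

mainTheorem6 : (n₁ n₂ : ℕ) → 1 ℕ.≤ n₁ → 1 ℕ.≤ n₂ → (B : Fin n₁ → Fin n₂ → Bool) →
    Connected B → (Ω : Vtx n₁ n₂ → Vtx n₁ n₂ → ℚ) → IsResistanceDistance B Ω →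
      (0ℚ ≤ cyclicity B Ω) × (cyclicity B Ω ≤ upperBound n₁ n₂)
      × ((cyclicity B Ω ≡ 0ℚ) ⇔ IsTree B)
      × ((cyclicity B Ω ≡ upperBound n₁ n₂) ⇔ IsComplete B)
mainTheorem6 n₁ n₂ 1≤n₁ 1≤n₂ B connected Ω isΩ =
  0≤cyclicity ,
  cyclicity≤upperBound ,
  mk⇔ (λ C≡0 → connected , unitResistances⇒acyclic (cyclicity≡0⇒unitResistances C≡0))
      (λ (_ , acyclic) → unitResistances⇒cyclicity≡0 (acyclic⇒unitResistances acyclic)) ,
  mk⇔ (cyclicity≡upperBound⇒complete connected) complete⇒cyclicity≡upperBound
  where open Resistances 1≤n₁ 1≤n₂ B Ω isΩ
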